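{- Let $G=(V,E)$ be a graph and let $W$ be a closed walk in $G$ that visits every vertex and traverses every edge of $G$ (edges may be traversed multiple times). Let $|W|$ denote the length of $W$. Then there is a sequence of exactly $|W|-|V(G)|$ inclusive vertex splits transforming $G$ into a single cycle.
   Context: All graphs are finite, simple and undirected. An inclusive vertex split of a vertex $v$ removes $v$ and adds two new vertices $v_1,v_2$ with $N(v_1)\cup N(v_2)=N(v)$ ($N(v_1)$ and $N(v_2)$ may intersect); no other adjacencies change. The length of a walk is its number of edge traversals, counted with multiplicity. -}

module Defs where

open import Data.Nat using (ℕ; zero; suc; _≤_)
open import Data.Fin using (Fin; toℕ; inject₁; fromℕ) renaming (suc to fsuc; zero to fzero)
open import Data.Bool using (Bool; true; false)
open import Data.Product using (Σ; ∃; _×_; _,_)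
open import Data.Sum using (_⊎_)
open import Relation.Binary.PropositionalEquality using (_≡_; _≢_)
open import Function.Definitions using (Bijective)

record Graph : Set where
  field
    n     : ℕ
    adj   : Fin n → Fin n → Bool
    sym   : ∀ i j → adj i j ≡ adj j i
    irrfl : ∀ i → adj i i ≡ false
open Graph public

V : Graph → Set
V G = Fin (n G)

Adj : (G : Graph) → V G → V G → Set
Adj G u w = adj G u w ≡ true

record ClosedWalk (G : Graph) (L : ℕ) : Set where
  field
    vtx    : Fin (suc L) → V G
    step   : ∀ (i : Fin L) → Adj G (vtx (inject₁ i)) (vtx (fsuc i))
    closed : vtx fzero ≡ vtx (fromℕ L)
open ClosedWalk public

VisitsAllVertices : ∀ {G L} → ClosedWalk G L → Set
VisitsAllVertices {G} {L} W = ∀ (u : V G) → ∃ λ (i : Fin (suc L)) → vtx W i ≡ u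

TraversesAllEdges : ∀ {G L} → ClosedWalk G L → Set
TraversesAllEdges {G} {L} W =
  ∀ (u w : V G) → Adj G u w →
    ∃ λ (i : Fin L) →
      (vtx W (inject₁ i) ≡ u × vtx W (fsuc i) ≡ w)
      ⊎ (vtx W (inject₁ i) ≡ w × vtx W (fsuc i) ≡ u)

-- H is obtained from G by one inclusive vertex split of the vertex v.
-- f : V H → V G sends v₁, v₂ to v and is a bijection from the remaining
-- vertices of H onto V G ∖ {v}; adjacencies not involving v are unchanged;
-- N(v₁), N(v₂) ⊆ N(v) and N(v₁) ∪ N(v₂) = N(v)  (via f).
record InclusiveSplit (G H : Graph) : Set where
  field
    f       : V H → V G
    v       : V G
    v₁ v₂   : V H
    v₁≢v₂   : v₁ ≢ v₂
    f-v₁    : f v₁ ≡ v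
    f-v₂    : f v₂ ≡ v
    fib-v   : ∀ x → f x ≡ v → x ≡ v₁ ⊎ x ≡ v₂
    surj    : ∀ u → ∃ λ x → f x ≡ u
    inj-off : ∀ x y → f x ≡ f y → f x ≢ v → x ≡ y
    adj-off : ∀ x y → f x ≢ v → f y ≢ v → adj H x y ≡ adj G (f x) (f y)
    adj-new : ∀ x y → f x ≡ v → Adj H x y → f y ≢ v × Adj G v (f y)
    cover   : ∀ y → f y ≢ v → Adj G v (f y) → Adj H v₁ y ⊎ Adj H v₂ y

data Splits : ℕ → Graph → Graph → Set where
  done : ∀ {G} → Splits zero G G
  split : ∀ {k G H K} → InclusiveSplit G H → Splits k H K → Splits (suc k) G K

CycNext : (m : ℕ) → Fin m → Fin m → Set
CycNext m i j = (suc (toℕ i) ≡ toℕ j) ⊎ (suc (toℕ i) ≡ m × toℕ j ≡ 0)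

IsCycle : Graph → Set
IsCycle H =
  3 ≤ n H ×
  Σ (Fin (n H) → V H) λ σ →
    Bijective _≡_ _≡_ σ ×
    (∀ i j → Adj H (σ i) (σ j) → CycNext (n H) i j ⊎ CycNext (n H) j i) ×
    (∀ i j → CycNext (n H) i j → Adj H (σ i) (σ j))

{-# OPTIONS --safe #-}

-- A closed walk of length L presents G as the image of the cycle C_L under the map c
-- sending each position to the vertex visited there: c is onto, and the edges of G are
-- exactly the images of cycle edges. While n G < L, pigeonhole gives positions i ≠ j with
-- c i = c j = v; splitting v so that position j alone moves to a new vertex is an inclusive
-- split, and the new graph is again the image of C_L. After L ∸ n G splits c is an onto
-- self-map of Fin L, hence a bijection, and the graph is C_L itself.
module Submission where

open import Defs hiding (sym)
open import Data.Nat using (ℕ; zero; suc; _+_; _∸_; _≤_; _<_; s≤s)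
open import Data.Nat.Properties using (+-suc; m∸n+n≡m; m≤n+m; n≮n)
import Data.Nat as ℕ
open import Data.Fin using (Fin; toℕ; inject₁; fromℕ; punchIn; punchOut; _≟_)
  renaming (zero to fzero; suc to fsuc)
open import Data.Fin.Properties
  using (any?; pigeonhole; injective⇒≤; toℕ-injective; toℕ-inject₁; toℕ-fromℕ; <⇒≢; punchIn-punchOut)
open import Data.Bool using (Bool; true; false)
open import Data.Product using (Σ; ∃; ∃₂; _×_; _,_; proj₁; proj₂)
open import Data.Sum using (_⊎_; inj₁; inj₂; swap)
open import Function using (_∘_; _⇔_; mk⇔; Equivalence)
open import Function.Definitions using (Injective; StrictlySurjective)
open import Function.Consequences.Propositional using (strictlySurjective⇒surjective)
open import Relation.Nullary using (Dec; yes; no; does; ¬_; contradiction)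
open import Relation.Nullary.Decidable using (_×-dec_; _⊎-dec_; dec-true; dec-false; does-⇔)
open import Relation.Binary.PropositionalEquality
  using (_≡_; _≢_; refl; sym; trans; cong; subst; module ≡-Reasoning)

Adj-sym : (G : Graph) {a b : V G} → Adj G a b → Adj G b a
Adj-sym G {a} {b} p = trans (Graph.sym G b a) p

Adj-irrefl : (G : Graph) {a : V G} → ¬ Adj G a a
Adj-irrefl G {a} p with () ← trans (sym (irrfl G a)) p

dec-true⁻¹ : ∀ {A : Set} (a? : Dec A) → does a? ≡ true → A
dec-true⁻¹ (yes a) _ = a

does-reflects : ∀ {A : Set} {b : Bool} (a? : Dec A) → A ⇔ (b ≡ true) → does a? ≡ b
does-reflects (yes a) a⇔b = sym (Equivalence.to a⇔b a)
does-reflects {b = false} (no _) _ = refl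
does-reflects {b = true} (no ¬a) a⇔b = contradiction (Equivalence.from a⇔b refl) ¬a

strictlySurjective⇒≤ : ∀ {m n} {f : Fin m → Fin n} → StrictlySurjective _≡_ f → n ≤ m
strictlySurjective⇒≤ {f = f} onto = injective⇒≤ section-injective
  where
  section-injective : Injective _≡_ _≡_ (proj₁ ∘ onto)
  section-injective {a} {b} e = trans (sym (proj₂ (onto a))) (trans (cong f e) (proj₂ (onto b)))

strictlySurjective-collapse⇒< : ∀ {m n} {f : Fin m → Fin n} → StrictlySurjective _≡_ f →
                                ∀ {i j} → i ≢ j → f i ≡ f j → n < m
strictlySurjective-collapse⇒< {suc m} {f = f} onto {i} {j} i≢j fi≡fj =
  s≤s (strictlySurjective⇒≤ {f = f ∘ punchIn i} onto-without-i)
  where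
  onto-without-i : StrictlySurjective _≡_ (f ∘ punchIn i)
  onto-without-i y with onto y
  ... | k , fk≡y with i ≟ k
  ...   | no i≢k   = punchOut i≢k , trans (cong f (punchIn-punchOut i≢k)) fk≡y
  -- the value at the dropped point i is still taken, at j
  ...   | yes refl = punchOut i≢j , trans (cong f (punchIn-punchOut i≢j)) (trans (sym fi≡fj) fk≡y)

strictlySurjective⇒injective : ∀ {n} {f : Fin n → Fin n} → StrictlySurjective _≡_ f → Injective _≡_ _≡_ f
strictlySurjective⇒injective onto {i} {j} fi≡fj with i ≟ j
... | yes i≡j = i≡j
... | no i≢j = contradiction (strictlySurjective-collapse⇒< onto i≢j fi≡fj) (n≮n _)

last-or-inject₁ : ∀ {n} (i : Fin (suc n)) → i ≡ fromℕ n ⊎ ∃ λ k → inject₁ k ≡ i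
last-or-inject₁ {zero} fzero = inj₁ refl
last-or-inject₁ {suc n} fzero = inj₂ (fzero , refl)
last-or-inject₁ {suc n} (fsuc i) with last-or-inject₁ i
... | inj₁ i≡last = inj₁ (cong fsuc i≡last)
... | inj₂ (k , k≡i) = inj₂ (fsuc k , cong fsuc k≡i)

CycEdge : (L : ℕ) → Fin L → Fin L → Set
CycEdge L i j = CycNext L i j ⊎ CycNext L j i

cycNext? : ∀ L (i j : Fin L) → Dec (CycNext L i j)
cycNext? L i j = (suc (toℕ i) ℕ.≟ toℕ j) ⊎-dec ((suc (toℕ i) ℕ.≟ L) ×-dec (toℕ j ℕ.≟ 0))

cycEdge? : ∀ L (i j : Fin L) → Dec (CycEdge L i j)
cycEdge? L i j = cycNext? L i j ⊎-dec cycNext? L j i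

module _ {L m : ℕ} where

  ImageEdge : (Fin L → Fin m) → Fin m → Fin m → Set
  ImageEdge c a b = ∃₂ λ i j → CycEdge L i j × c i ≡ a × c j ≡ b

  imageEdge? : ∀ c a b → Dec (ImageEdge c a b)
  imageEdge? c a b = any? λ i → any? λ j → cycEdge? L i j ×-dec ((c i ≟ a) ×-dec (c j ≟ b))

  ImageEdge-sym : ∀ {c a b} → ImageEdge c a b → ImageEdge c b a
  ImageEdge-sym (i , j , ij , ci , cj) = j , i , swap ij , cj , ci

  Loopless : (Fin L → Fin m) → Set
  Loopless c = ∀ {i j} → CycEdge L i j → c i ≢ c j

  imageGraph : (c : Fin L → Fin m) → Loopless c → Graph
  imageGraph c loopless = record
    { n     = m
    ; adj   = λ a b → does (imageEdge? c a b)
    ; sym   = λ a b → does-⇔ (mk⇔ ImageEdge-sym ImageEdge-sym) (imageEdge? c a b) (imageEdge? c b a)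
    ; irrfl = λ a → dec-false (imageEdge? c a a) λ (i , j , ij , ci , cj) → loopless ij (trans ci (sym cj))
    }

record CycleImage {L : ℕ} (G : Graph) (c : Fin L → V G) : Set where
  field
    onto : StrictlySurjective _≡_ c
    lift : ∀ {a b} → Adj G a b → ImageEdge c a b
    hom  : ∀ {i j} → CycEdge L i j → Adj G (c i) (c j)

  image-adj : ∀ {a b} → ImageEdge c a b → Adj G a b
  image-adj (i , j , ij , refl , refl) = hom ij

  loopless : Loopless c
  loopless ij ci≡cj = Adj-irrefl G (subst (λ x → Adj G x (c _)) ci≡cj (hom ij))

  size≤ : n G ≤ L
  size≤ = strictlySurjective⇒≤ onto

imageGraph-cycleImage : ∀ {L m} {c : Fin L → Fin m} (loopless : Loopless c) →
                        StrictlySurjective _≡_ c → CycleImage (imageGraph c loopless) c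
imageGraph-cycleImage {c = c} _ onto = record
  { onto = onto
  ; lift = dec-true⁻¹ (imageEdge? c _ _)
  ; hom  = λ {i} {j} ij → dec-true (imageEdge? c (c i) (c j)) (i , j , ij , refl , refl)
  }

module Detach {L m : ℕ} (c : Fin L → Fin m) (j : Fin L) where

  detach : Fin L → Fin (suc m)
  detach k with k ≟ j
  ... | yes _ = fzero
  ... | no _  = fsuc (c k)

  merge : Fin (suc m) → Fin m
  merge fzero    = c j
  merge (fsuc x) = x

  merge-detach : ∀ k → merge (detach k) ≡ c k
  merge-detach k with k ≟ j
  ... | yes refl = refl
  ... | no _     = refl

  detach-j : detach j ≡ fzero
  detach-j with j ≟ j
  ... | yes _  = refl
  ... | no j≢j = contradiction refl j≢j

  detach-off : ∀ {k} → k ≢ j → detach k ≡ fsuc (c k)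
  detach-off {k} k≢j with k ≟ j
  ... | yes k≡j = contradiction k≡j k≢j
  ... | no _    = refl

  merge-fibre : ∀ x → merge x ≡ c j → x ≡ fsuc (c j) ⊎ x ≡ fzero
  merge-fibre fzero    _    = inj₂ refl
  merge-fibre (fsuc x) x≡cj = inj₁ (cong fsuc x≡cj)

  merge-injective-off : ∀ x y → merge x ≡ merge y → merge x ≢ c j → x ≡ y
  merge-injective-off fzero    _        _ x≢cj   = contradiction refl x≢cj
  merge-injective-off (fsuc x) fzero    x≡cj x≢cj = contradiction x≡cj x≢cj
  merge-injective-off (fsuc x) (fsuc y) x≡y  _    = cong fsuc x≡y

  detach-unique : ∀ k x → c k ≡ merge x → merge x ≢ c j → detach k ≡ x
  detach-unique k fzero    _    x≢cj = contradiction refl x≢cj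
  detach-unique k (fsuc x) ck≡x x≢cj with k ≟ j
  ... | yes refl = contradiction (sym ck≡x) x≢cj
  ... | no _     = cong fsuc ck≡x

  detach-onto : ∀ {i} → i ≢ j → c i ≡ c j → StrictlySurjective _≡_ c → StrictlySurjective _≡_ detach
  detach-onto _ _ _ fzero = j , detach-j
  detach-onto {i} i≢j ci≡cj onto (fsuc x) with onto x
  ... | k , ck≡x with k ≟ j
  ...   | no k≢j   = k , trans (detach-off k≢j) (cong fsuc ck≡x)
  ...   | yes refl = i , trans (detach-off i≢j) (cong fsuc (trans ci≡cj ck≡x))

  imageEdge-merge : ∀ {x y} → ImageEdge detach x y → ImageEdge c (merge x) (merge y)
  imageEdge-merge (k , l , kl , refl , refl) = k , l , kl , sym (merge-detach k) , sym (merge-detach l)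

  imageEdge-detach : ∀ {x y} → merge x ≢ c j → merge y ≢ c j →
                     ImageEdge c (merge x) (merge y) → ImageEdge detach x y
  imageEdge-detach {x} {y} x≢cj y≢cj (k , l , kl , ck , cl) =
    k , l , kl , detach-unique k x ck x≢cj , detach-unique l y cl y≢cj

module CollapsedSplit {L : ℕ} {G : Graph} {c : Fin L → V G} (img : CycleImage G c)
                      {i j : Fin L} (i≢j : i ≢ j) (ci≡cj : c i ≡ c j) where
  open Detach c j
  open CycleImage img

  detach-loopless : Loopless detach
  detach-loopless {k} {l} kl dk≡dl =
    loopless kl (trans (sym (merge-detach k)) (trans (cong merge dk≡dl) (merge-detach l)))

  H : Graph
  H = imageGraph detach detach-loopless

  H-image : CycleImage H detach
  H-image = imageGraph-cycleImage detach-loopless (detach-onto i≢j ci≡cj onto)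

  private
    module H = CycleImage H-image

  merge-hom : ∀ {x y} → Adj H x y → Adj G (merge x) (merge y)
  merge-hom = image-adj ∘ imageEdge-merge ∘ H.lift

  adj-off : ∀ x y → merge x ≢ c j → merge y ≢ c j → adj H x y ≡ adj G (merge x) (merge y)
  adj-off x y x≢cj y≢cj = does-reflects (imageEdge? detach x y)
    (mk⇔ (image-adj ∘ imageEdge-merge) (imageEdge-detach x≢cj y≢cj ∘ lift))

  adj-new : ∀ x y → merge x ≡ c j → Adj H x y → merge y ≢ c j × Adj G (c j) (merge y)
  adj-new x y x≡cj xy = (λ y≡cj → Adj-irrefl G (subst (λ z → Adj G (c j) z) y≡cj cj~y)) , cj~y
    where
    cj~y : Adj G (c j) (merge y)
    cj~y = subst (λ z → Adj G z (merge y)) x≡cj (merge-hom xy)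

  fibre-adj : ∀ {x y} → merge x ≡ c j → Adj H x y → Adj H (fsuc (c j)) y ⊎ Adj H fzero y
  fibre-adj {x} x≡cj xy with merge-fibre x x≡cj
  ... | inj₁ refl = inj₁ xy
  ... | inj₂ refl = inj₂ xy

  cover : ∀ y → merge y ≢ c j → Adj G (c j) (merge y) → Adj H (fsuc (c j)) y ⊎ Adj H fzero y
  cover y y≢cj cj~y with lift cj~y
  ... | k , l , kl , ck≡cj , cl≡y =
    fibre-adj (trans (merge-detach k) ck≡cj)
              (subst (Adj H (detach k)) (detach-unique l y cl≡y y≢cj) (H.hom kl))

  inclusiveSplit : InclusiveSplit G H
  inclusiveSplit = record
    { f       = merge
    ; v       = c j
    ; v₁      = fsuc (c j)
    ; v₂      = fzero
    ; v₁≢v₂   = λ ()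
    ; f-v₁    = refl
    ; f-v₂    = refl
    ; fib-v   = merge-fibre
    ; surj    = λ u → fsuc u , refl
    ; inj-off = merge-injective-off
    ; adj-off = adj-off
    ; adj-new = adj-new
    ; cover   = cover
    }

splitCollapses : ∀ d {L G} {c : Fin L → V G} → CycleImage G c → d + n G ≡ L →
                 ∃ λ H → Splits d G H × Σ (Fin L → V H) (CycleImage H) × n H ≡ L
splitCollapses zero img size = _ , done , (_ , img) , size
splitCollapses (suc d) {G = G} {c} img size
  with i , j , i<j , ci≡cj ← pigeonhole (subst (n G <_) size (s≤s (m≤n+m (n G) d))) c
  = let K , splits , K-image = splitCollapses d H-image (trans (+-suc d (n G)) size)
    in K , split inclusiveSplit splits , K-image
  where open CollapsedSplit img (<⇒≢ i<j) ci≡cj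

cycleImage⇒isCycle : ∀ {L G} {c : Fin L → V G} → CycleImage G c → n G ≡ L → 3 ≤ L → IsCycle G
cycleImage⇒isCycle {G = G} {c} img refl 3≤n =
  3≤n , c , (injective , strictlySurjective⇒surjective onto) , reflect , λ _ _ → hom ∘ inj₁
  where
  open CycleImage img
  injective : Injective _≡_ _≡_ c
  injective = strictlySurjective⇒injective onto
  reflect : ∀ i j → Adj G (c i) (c j) → CycEdge (n G) i j
  reflect i j ij with k , l , kl , ck≡ci , cl≡cj ← lift ij
    with refl ← injective ck≡ci | refl ← injective cl≡cj = kl

module WalkImage {G : Graph} {L : ℕ} (W : ClosedWalk G (suc L)) where

  position : Fin (suc L) → V G
  position k = vtx W (inject₁ k)

  vtx-after : ∀ {i j} → CycNext (suc L) i j → vtx W (fsuc i) ≡ position j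
  vtx-after {i} {j} (inj₁ i+1≡j) = cong (vtx W) (toℕ-injective (trans i+1≡j (sym (toℕ-inject₁ j))))
  vtx-after {i} {j} (inj₂ (i+1≡L , j≡0)) = begin
    vtx W (fsuc i)        ≡⟨ cong (vtx W) (toℕ-injective (trans i+1≡L (sym (toℕ-fromℕ (suc L))))) ⟩
    vtx W (fromℕ (suc L)) ≡⟨ sym (closed W) ⟩
    position fzero        ≡⟨ cong position (toℕ-injective (sym j≡0)) ⟩
    position j            ∎
    where open ≡-Reasoning

  successor : ∀ i → ∃ λ j → CycNext (suc L) i j
  successor i with last-or-inject₁ (fsuc i)
  ... | inj₁ i+1≡last    = fzero , inj₂ (trans (cong toℕ i+1≡last) (toℕ-fromℕ (suc L)) , refl)
  ... | inj₂ (k , k≡i+1) = k , inj₁ (trans (cong toℕ (sym k≡i+1)) (toℕ-inject₁ k))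

  step-adj : ∀ {i j} → CycNext (suc L) i j → Adj G (position i) (position j)
  step-adj {i} ij = subst (Adj G (position i)) (vtx-after ij) (step W i)

  walk-cycleImage : VisitsAllVertices W → TraversesAllEdges W → CycleImage G position
  walk-cycleImage visits traverses = record { onto = position-onto ; lift = edge-lift ; hom = edge-hom }
    where
    position-onto : StrictlySurjective _≡_ position
    position-onto u with i , wi≡u ← visits u with last-or-inject₁ i
    ... | inj₁ refl       = fzero , trans (closed W) wi≡u
    ... | inj₂ (k , refl) = k , wi≡u

    edge-lift : ∀ {a b} → Adj G a b → ImageEdge position a b
    edge-lift {a} {b} ab with i , traversal ← traverses a b ab with j , ij ← successor i with traversal
    ... | inj₁ (wi≡a , wi+1≡b) = i , j , inj₁ ij , wi≡a , trans (sym (vtx-after ij)) wi+1≡b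
    ... | inj₂ (wi≡b , wi+1≡a) = j , i , inj₂ ij , trans (sym (vtx-after ij)) wi+1≡a , wi≡b

    edge-hom : ∀ {i j} → CycEdge (suc L) i j → Adj G (position i) (position j)
    edge-hom (inj₁ ij) = step-adj ij
    edge-hom (inj₂ ji) = Adj-sym G (step-adj ji)

lemma5 : (G : Graph) (L : ℕ) (W : ClosedWalk G L) →
         VisitsAllVertices W → TraversesAllEdges W →
         3 ≤ L →
         ∃ λ (H : Graph) → Splits (L ∸ n G) G H × IsCycle H
lemma5 G (suc L) W visits traverses 3≤L =
  let H , splits , (_ , H-image) , size = splitCollapses (suc L ∸ n G) G-image (m∸n+n≡m size≤)
  in H , splits , cycleImage⇒isCycle H-image size 3≤L
  where
  open WalkImage W
  G-image : CycleImage G position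
  G-image = walk-cycleImage visits traverses
  open CycleImage G-image using (size≤)
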